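{- Let $\mathcal P\subseteq\mathbf{AF}$ be a hereditary property of arrow finite quivers such that there exists at least one finite quiver not carrying the property $\mathcal P$. Then $\mathcal P\cap\mathbf{LF}$ is not dense in $\mathbf{LF}$, and $\mathcal P$ is not dense in $\mathbf{AF}$. On the other hand, $\mathbf{LF}\setminus\mathcal P$ is dense in $\mathbf{LF}$ and $\mathbf{AF}\setminus\mathcal P$ is dense in $\mathbf{AF}$. Moreover, $\mathcal P=\mathcal P_{\mathcal F}$ for some (possibly infinite) family $\mathcal F$ of finite unlabeled quivers if and only if $\mathcal P$ is closed in $\mathbf{AF}$.
   Context: A quiver on a set $X$ is a function $Q:X\times X\to\mathbb{Z}$ with $Q(x,y)=-Q(y,x)$ for all $x,y$. $\mathbf{AF}^X$ is the set of all quivers on $X$; $Q$ is locally finite if $\sum_{y}|Q(x,y)|<\infty$ for all $x$, and finite if $\sum_{x,y}|Q(x,y)|<\infty$. For $V\subseteq X$, $\rho_V(Q)(x,y)=Q(x,y)$ if $x,y\in V$ and $0$ otherwise (restriction; $\rho_V(Q)$ is called a full subquiver of $Q$, finite if $V$ is finite); $\lambda_V(Q)(x,y)=Q(x,y)$ if $x\in V$ or $y\in V$ and $0$ otherwise. For $Q\in\mathbf{AF}^X$, finite $V\subseteq X$: $U_{Q,V}=\{Q':\rho_V(Q')=\rho_V(Q)\}$, $W_{Q,V}=\{Q':\lambda_V(Q')=\lambda_V(Q)\}$. $\mathbb{N}$ is the positive integers. $\mathbf{AF}$ denotes $\mathbf{AF}^{\mathbb{N}}$ with the topology generated by the basis $\{U_{Q,V}\}$;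 $\mathbf{LF}$ denotes the set of locally finite quivers on $\mathbb{N}$ with the topology generated by the basis $\{W_{Q,V}\cap\mathbf{LF}\}$. A property of quivers is a subset $\mathcal P\subseteq\mathbf{AF}$ invariant under relabeling vertices (i.e. under isomorphism). $\mathcal P$ is hereditary if whenever $Q\in\mathcal P$, every finite full subquiver of $Q$ also lies in $\mathcal P$. For a family $\mathcal F$ of finite unlabeled quivers (isomorphism classes of quivers on finite vertex sets), $\mathcal P_{\mathcal F}$ is the set of $Q\in\mathbf{AF}$ such that for no finite $V\subseteq\mathbb{N}$ is the quiver $Q|_{V\times V}$ on $V$ isomorphic to a member of $\mathcal F$. -}

module Defs where

open import Data.Nat using (ℕ; _≟_)
open import Data.Integer using (ℤ; -_; 0ℤ)
open import Data.Bool using (Bool; true; false; if_then_else_; _∧_; _∨_)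
open import Data.Bool.Properties using (∧-comm; ∨-comm)
open import Data.Fin using (Fin)
open import Data.List using (List)
open import Data.List.Membership.Propositional using (_∈_; _∉_)
open import Data.List.Membership.DecPropositional _≟_ using (_∈?_)
open import Data.Product using (Σ; ∃; _×_)
open import Relation.Nullary using (¬_; does)
open import Relation.Binary.PropositionalEquality using (_≡_; refl)
open import Function.Bundles using (_↔_; Inverse)

-- Vertices are ℕ = {0,1,2,...} (a harmless relabelling of the positive integers).

-- A quiver on ℕ: a skew-symmetric ℤ-valued function (element of AF).
record Quiver : Set where
  field
    arr  : ℕ → ℕ → ℤ
    skew : ∀ x y → arr x y ≡ - arr y x
open Quiver public

record FQuiver (n : ℕ) : Set where
  field
    farr  : Fin n → Fin n → ℤ
    fskew : ∀ i j → farr i j ≡ - farr j i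
open FQuiver public

-- Finite vertex subsets V ⊆ ℕ are given by lists.
inV : List ℕ → ℕ → Bool
inV V x = does (x ∈? V)

private
  ifskew : (b : Bool) (a c : ℤ) → a ≡ - c →
           (if b then a else 0ℤ) ≡ - (if b then c else 0ℤ)
  ifskew true  a c p = p
  ifskew false a c p = refl

  rhoSkew : (V : List ℕ) (Q : Quiver) (x y : ℕ) →
    (if inV V x ∧ inV V y then arr Q x y else 0ℤ)
      ≡ - (if inV V y ∧ inV V x then arr Q y x else 0ℤ)
  rhoSkew V Q x y rewrite ∧-comm (inV V y) (inV V x) =
    ifskew (inV V x ∧ inV V y) (arr Q x y) (arr Q y x) (skew Q x y)

  lamSkew : (V : List ℕ) (Q : Quiver) (x y : ℕ) →
    (if inV V x ∨ inV V y then arr Q x y else 0ℤ)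
      ≡ - (if inV V y ∨ inV V x then arr Q y x else 0ℤ)
  lamSkew V Q x y rewrite ∨-comm (inV V y) (inV V x) =
    ifskew (inV V x ∨ inV V y) (arr Q x y) (arr Q y x) (skew Q x y)

ρ : List ℕ → Quiver → Quiver
arr  (ρ V Q) x y = if inV V x ∧ inV V y then arr Q x y else 0ℤ
skew (ρ V Q) x y = rhoSkew V Q x y

Λ : List ℕ → Quiver → Quiver
arr  (Λ V Q) x y = if inV V x ∨ inV V y then arr Q x y else 0ℤ
skew (Λ V Q) x y = lamSkew V Q x y

_≈Q_ : Quiver → Quiver → Set
Q ≈Q Q' = ∀ x y → arr Q x y ≡ arr Q' x y

InU : Quiver → List ℕ → Quiver → Set
InU Q V Q' = ρ V Q' ≈Q ρ V Q

InW : Quiver → List ℕ → Quiver → Set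
InW Q V Q' = Λ V Q' ≈Q Λ V Q

-- Locally finite: each row has only finitely many nonzero entries
-- (for ℤ-valued entries this is Σ_y |Q(x,y)| < ∞).
LocFin : Quiver → Set
LocFin Q = ∀ x → Σ (List ℕ) λ S → ∀ y → y ∉ S → arr Q x y ≡ 0ℤ

-- Finite: only finitely many nonzero entries (Σ_{x,y} |Q(x,y)| < ∞).
Finite : Quiver → Set
Finite Q = Σ (List ℕ) λ S → ∀ x y → x ∉ S → arr Q x y ≡ 0ℤ

QSet : Set₁
QSet = Quiver → Set

IsProperty : QSet → Set
IsProperty P = ∀ (Q Q' : Quiver) (σ : ℕ ↔ ℕ) →
  (∀ x y → arr Q' (Inverse.to σ x) (Inverse.to σ y) ≡ arr Q x y) →
  P Q → P Q'

Hereditary : QSet → Set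
Hereditary P = ∀ (Q : Quiver) (V : List ℕ) → P Q → P (ρ V Q)

-- S is dense in AF: meets every basic open set U_{Q,V}.
DenseAF : QSet → Set
DenseAF S = ∀ (Q : Quiver) (V : List ℕ) → Σ Quiver λ Q' → S Q' × InU Q V Q'

-- S ∩ LF is dense in LF: meets every nonempty basic open W_{Q,V} ∩ LF
-- (every nonempty one is of the form W_{Q,V} ∩ LF with Q ∈ LF).
DenseLF : QSet → Set
DenseLF S = ∀ (Q : Quiver) → LocFin Q → (V : List ℕ) →
  Σ Quiver λ Q' → LocFin Q' × S Q' × InW Q V Q'

-- S is closed in AF: its complement is open, i.e. every point outside S
-- has a basic neighbourhood U_{Q,V} disjoint from S.
ClosedAF : QSet → Set
ClosedAF S = ∀ (Q : Quiver) → ¬ S Q →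
  Σ (List ℕ) λ V → ∀ (Q' : Quiver) → InU Q V Q' → ¬ S Q'

-- A family of finite unlabeled quivers, given by representatives
-- (membership of a quiver on Fin n for some n).
Family : Set₁
Family = (n : ℕ) → FQuiver n → Set

RestrIso : Quiver → List ℕ → (n : ℕ) → FQuiver n → Set
RestrIso Q V n G = Σ (Fin n → ℕ) λ f →
  (∀ i j → f i ≡ f j → i ≡ j) ×
  (∀ i → f i ∈ V) ×
  (∀ x → x ∈ V → ∃ λ i → f i ≡ x) ×
  (∀ i j → arr Q (f i) (f j) ≡ farr G i j)

P[_] : Family → QSet
P[ F ] Q = ∀ (V : List ℕ) →
  ¬ (Σ ℕ λ n → Σ (FQuiver n) λ G → F n G × RestrIso Q V n G)

{-# OPTIONS --safe #-}
module Submission where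

-- A finite quiver Q₀ ∉ P supported on S₀ keeps P out of its neighbourhood U_{Q₀,S₀} ⊇ W_{Q₀,S₀}:
-- any Q there has ρ_{S₀} Q = Q₀, so Q ∉ P by heredity. Conversely, every basic open set
-- U_{Q,V}, or W_{Q,V} ∩ LF, contains a finite quiver (ρ_V Q, resp. λ_V Q for locally finite Q);
-- adding to it a copy of Q₀ relabelled onto vertices outside its support stays in the open set
-- and contains Q₀ as a full subquiver, hence lies outside P.
-- P_F is closed because an occurrence of a member of F lives on a finite V and so persists on
-- U_{Q,V}. If P is closed, let F consist of the finite quivers all of whose occurrences force
-- leaving P: a quiver Q ∉ P has a neighbourhood U_{Q,V} disjoint from P, and the restriction of Q
-- to {0, …, max V} lies in F because any occurrence of it can be relabelled into U_{Q,V}.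
-- Both closedness arguments use excluded middle.

open import Defs
open import Level using (0ℓ)
open import Axiom.ExcludedMiddle using (ExcludedMiddle)
open import Data.Bool using (true; false)
open import Data.Empty using (⊥-elim)
open import Data.Fin using (Fin; toℕ; fromℕ<)
open import Data.Fin.Properties using (toℕ-fromℕ<; toℕ-injective; toℕ<n)
open import Data.Integer as ℤ using (0ℤ; -_)
open import Data.Integer.Properties using (neg-distrib-+; +-identityˡ; +-identityʳ)
open import Data.Nat using (ℕ; suc; _+_; _<_; _<?_; _≟_; s≤s)
open import Data.Nat.Properties
  using (m<1+n⇒m<n∨m≡n; m<n⇒m<1+n; n<1+n; <-irrefl; +-cancelˡ-≡; m+n≮m)
open import Data.List using (List; _++_; map; upTo; concatMap)
open import Data.List.Extrema.Nat using (max; xs≤max)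
open import Data.List.Membership.Propositional using (_∈_; _∉_; lose)
open import Data.List.Membership.Propositional.Properties
  using (∈-map⁺; ∈-map⁻; ∈-++⁺ˡ; ∈-++⁺ʳ; ∈-concatMap⁺; ∈-upTo⁺; ∈-upTo⁻)
open import Data.List.Membership.DecPropositional _≟_ using (_∈?_)
import Data.List.Relation.Unary.All as All
open import Data.Product using (Σ; _×_; _,_; proj₁; proj₂; swap; curry)
open import Data.Sum using (inj₁; inj₂)
open import Function using (_∘_)
open import Function.Bundles using (_↔_; Inverse; mk↔ₛ′)
open import Function.Properties.Inverse using (↔-refl; ↔-sym; ↔-trans)
open import Relation.Nullary using (¬_; Dec; yes; no)
open import Relation.Nullary.Decidable using (dec-true; dec-false; decidable-stable)
open import Relation.Binary.PropositionalEquality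
  using (_≡_; _≢_; refl; sym; trans; cong; cong₂; subst; module ≡-Reasoning)

open Inverse using (to; from; strictlyInverseˡ; strictlyInverseʳ)

variable
  n : ℕ
  x y : ℕ
  S T V : List ℕ
  A B Q Q' : Quiver

-- Permutations of ℕ

transpose : ℕ → ℕ → ℕ → ℕ
transpose a b x with x ≟ a
... | yes _ = b
... | no _ with x ≟ b
...   | yes _ = a
...   | no _  = x

transpose-left : ∀ a b → transpose a b a ≡ b
transpose-left a b with a ≟ a
... | yes _  = refl
... | no a≢a = ⊥-elim (a≢a refl)

transpose-right : ∀ a b → transpose a b b ≡ a
transpose-right a b with b ≟ a
... | yes b≡a = b≡a
... | no _ with b ≟ b
...   | yes _  = refl
...   | no b≢b = ⊥-elim (b≢b refl)

transpose-other : ∀ {a b x} → x ≢ a → x ≢ b → transpose a b x ≡ x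
transpose-other {a} {b} {x} x≢a x≢b with x ≟ a
... | yes x≡a = ⊥-elim (x≢a x≡a)
... | no _ with x ≟ b
...   | yes x≡b = ⊥-elim (x≢b x≡b)
...   | no _    = refl

transpose-involutive : ∀ a b x → transpose a b (transpose a b x) ≡ x
transpose-involutive a b x = by-cases (x ≟ a) (x ≟ b)
  where
  by-cases : Dec (x ≡ a) → Dec (x ≡ b) → transpose a b (transpose a b x) ≡ x
  by-cases (yes refl) _          = trans (cong (transpose a b) (transpose-left a b)) (transpose-right a b)
  by-cases (no _)     (yes refl) = trans (cong (transpose a b) (transpose-right a b)) (transpose-left a b)
  by-cases (no x≢a)   (no x≢b)   =
    trans (cong (transpose a b) (transpose-other x≢a x≢b)) (transpose-other x≢a x≢b)

transpose↔ : ℕ → ℕ → ℕ ↔ ℕ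
transpose↔ a b =
  mk↔ₛ′ (transpose a b) (transpose a b) (transpose-involutive a b) (transpose-involutive a b)

-- If σ extends f on [0, n), the transposition of σ n and f n fixes every f i with i < n.
extend-injection : ∀ n (f : ℕ → ℕ) → (∀ {i j} → i < n → j < n → f i ≡ f j → i ≡ j) →
  Σ (ℕ ↔ ℕ) λ σ → ∀ {i} → i < n → to σ i ≡ f i
extend-injection 0       f f-inj = ↔-refl , λ ()
extend-injection (suc n) f f-inj =
  ↔-trans σ (transpose↔ (to σ n) (f n)) , extends
  where
  previous = extend-injection n f (λ i<n j<n → f-inj (m<n⇒m<1+n i<n) (m<n⇒m<1+n j<n))
  σ = proj₁ previous
  σ-extends = proj₂ previous

  extends : ∀ {i} → i < suc n → transpose (to σ n) (f n) (to σ i) ≡ f i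
  extends {i} i<1+n with m<1+n⇒m<n∨m≡n i<1+n
  ... | inj₂ refl = transpose-left (to σ n) (f n)
  ... | inj₁ i<n  =
    trans (cong (transpose (to σ n) (f n)) (σ-extends i<n)) (transpose-other fi≢σn fi≢fn)
    where
    fi≢σn : f i ≢ to σ n
    fi≢σn fi≡σn = <-irrefl (begin
      i                    ≡⟨ strictlyInverseʳ σ i ⟨
      from σ (to σ i)      ≡⟨ cong (from σ) (trans (σ-extends i<n) fi≡σn) ⟩
      from σ (to σ n)      ≡⟨ strictlyInverseʳ σ n ⟩
      n                    ∎) i<n
      where open ≡-Reasoning
    fi≢fn : f i ≢ f n
    fi≢fn fi≡fn = <-irrefl (f-inj (m<n⇒m<1+n i<n) (n<1+n n) fi≡fn) i<n

extend-injectionᶠ : (f : Fin n → ℕ) → (∀ i j → f i ≡ f j → i ≡ j) →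
  Σ (ℕ ↔ ℕ) λ σ → ∀ {x} (x<n : x < n) → to σ x ≡ f (fromℕ< x<n)
extend-injectionᶠ {n} f f-inj = σ , λ x<n → trans (σ-extends x<n) (total-on x<n)
  where
  total : ℕ → ℕ
  total x with x <? n
  ... | yes x<n = f (fromℕ< x<n)
  ... | no _    = 0

  total-on : ∀ {x} (x<n : x < n) → total x ≡ f (fromℕ< x<n)
  total-on {x} x<n with x <? n
  ... | yes _   = refl
  ... | no x≮n  = ⊥-elim (x≮n x<n)

  total-inj : ∀ {i j} → i < n → j < n → total i ≡ total j → i ≡ j
  total-inj {i} {j} i<n j<n total-i≡total-j = begin
    i                  ≡⟨ toℕ-fromℕ< i<n ⟨
    toℕ (fromℕ< i<n)   ≡⟨ cong toℕ (f-inj _ _ f-eq) ⟩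
    toℕ (fromℕ< j<n)   ≡⟨ toℕ-fromℕ< j<n ⟩
    j                  ∎
    where
      open ≡-Reasoning
      f-eq = trans (sym (total-on i<n)) (trans total-i≡total-j (total-on j<n))

  σ = proj₁ (extend-injection n total total-inj)
  σ-extends = proj₂ (extend-injection n total total-inj)

bound : List ℕ → ℕ
bound xs = suc (max 0 xs)

<-bound : x ∈ S → x < bound S
<-bound {S = S} x∈S = s≤s (All.lookup (xs≤max 0 S) x∈S)

separate : (S T : List ℕ) → Σ (ℕ ↔ ℕ) λ σ → ∀ {x} → x ∈ S → to σ x ∉ T
separate S T = σ , λ x∈S σx∈T →
  m+n≮m (bound T) _ (subst (_< bound T) (σ-shifts (<-bound x∈S)) (<-bound σx∈T))
  where
  shifted = extend-injection (bound S) (bound T +_) (λ _ _ → +-cancelˡ-≡ (bound T) _ _)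
  σ = proj₁ shifted
  σ-shifts = proj₂ shifted

-- Supports, restriction and incidence

SupportedOn : List ℕ → Quiver → Set
SupportedOn S Q = ∀ x y → x ∉ S → arr Q x y ≡ 0ℤ

supported-column : SupportedOn S Q → y ∉ S → arr Q x y ≡ 0ℤ
supported-column {Q = Q} {y = y} {x = x} supp y∉S =
  trans (skew Q x y) (cong -_ (supp y x y∉S))

finite⇒locFin : Finite Q → LocFin Q
finite⇒locFin {Q = Q} (S , supp) x = S , λ y y∉S → supported-column {Q = Q} supp y∉S

column-agrees : (∀ z → arr A y z ≡ arr B y z) → arr A x y ≡ arr B x y
column-agrees {A = A} {y = y} {B = B} {x = x} row-agrees = begin
  arr A x y      ≡⟨ skew A x y ⟩
  - arr A y x    ≡⟨ cong -_ (row-agrees x) ⟩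
  - arr B y x    ≡⟨ skew B x y ⟨
  arr B x y      ∎
  where open ≡-Reasoning

∈⇒inV : x ∈ V → inV V x ≡ true
∈⇒inV = dec-true (_ ∈? _)

∉⇒inV : x ∉ V → inV V x ≡ false
∉⇒inV = dec-false (_ ∈? _)

ρ-inside : x ∈ V → y ∈ V → arr (ρ V Q) x y ≡ arr Q x y
ρ-inside x∈V y∈V rewrite ∈⇒inV x∈V | ∈⇒inV y∈V = refl

Λ-insideˡ : x ∈ V → arr (Λ V Q) x y ≡ arr Q x y
Λ-insideˡ x∈V rewrite ∈⇒inV x∈V = refl

ρ-cong : (∀ {x y} → x ∈ V → y ∈ V → arr A x y ≡ arr B x y) → ρ V A ≈Q ρ V B
ρ-cong {V = V} agree x y with x ∈? V | y ∈? V
... | yes x∈V | yes y∈V = agree x∈V y∈V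
... | no _    | _       = refl
... | yes _   | no _    = refl

Λ-cong : (∀ {x} → x ∈ V → ∀ y → arr A x y ≡ arr B x y) → Λ V A ≈Q Λ V B
Λ-cong {V = V} {A = A} {B = B} agree x y with x ∈? V | y ∈? V
... | yes x∈V | _       = agree x∈V y
... | no _    | yes y∈V = column-agrees {A = A} {B = B} (agree y∈V)
... | no _    | no _    = refl

InW⇒InU : InW Q V Q' → InU Q V Q'
InW⇒InU {Q = Q} {V = V} {Q' = Q'} Q'∈W =
  ρ-cong {V = V} {A = Q'} {B = Q} λ x∈V _ →
    trans (sym (Λ-insideˡ {Q = Q'} x∈V)) (trans (Q'∈W _ _) (Λ-insideˡ {Q = Q} x∈V))

ρ-support : SupportedOn S Q → ρ S Q ≈Q Q
ρ-support {S = S} {Q = Q} supp x y with x ∈? S | y ∈? S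
... | yes _   | yes _   = refl
... | no x∉S  | _       = sym (supp x y x∉S)
... | yes _   | no y∉S  = sym (supported-column {Q = Q} supp y∉S)

ρ-supported : ∀ V Q → SupportedOn V (ρ V Q)
ρ-supported V Q x y x∉V rewrite ∉⇒inV x∉V = refl

Λ-supported : ∀ V Q (lf : LocFin Q) → SupportedOn (V ++ concatMap (proj₁ ∘ lf) V) (Λ V Q)
Λ-supported V Q lf x y x∉ with x ∈? V | y ∈? V
... | yes x∈V | _       = ⊥-elim (x∉ (∈-++⁺ˡ x∈V))
... | no _    | yes y∈V =
  trans (skew Q x y) (cong -_ (proj₂ (lf y) x (x∉ ∘ ∈-++⁺ʳ V ∘ ∈-concatMap⁺ _ ∘ lose y∈V)))
... | no _    | no _    = refl

_⊕_ : Quiver → Quiver → Quiver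
arr  (A ⊕ B) x y = arr A x y ℤ.+ arr B x y
skew (A ⊕ B) x y =
  trans (cong₂ ℤ._+_ (skew A x y) (skew B x y)) (sym (neg-distrib-+ (arr A y x) (arr B y x)))

⊕-supported : SupportedOn S A → SupportedOn T B → SupportedOn (S ++ T) (A ⊕ B)
⊕-supported {S = S} suppA suppB x y x∉S++T =
  cong₂ ℤ._+_ (suppA x y (x∉S++T ∘ ∈-++⁺ˡ)) (suppB x y (x∉S++T ∘ ∈-++⁺ʳ S))

⊕-row-outside : ∀ A → SupportedOn T B → x ∉ T → ∀ y → arr (A ⊕ B) x y ≡ arr A x y
⊕-row-outside {x = x} A suppB x∉T y =
  trans (cong (λ b → arr A x y ℤ.+ b) (suppB x y x∉T)) (+-identityʳ (arr A x y))

ρ-⊕-disjoint : SupportedOn S A → SupportedOn T B → (∀ {x} → x ∈ T → x ∉ S) → ρ T (A ⊕ B) ≈Q B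
ρ-⊕-disjoint {S = S} {A = A} {T = T} {B = B} suppA suppB disjoint x y = begin
  arr (ρ T (A ⊕ B)) x y   ≡⟨ ρ-cong {V = T} {A = A ⊕ B} {B = B} drop-A x y ⟩
  arr (ρ T B) x y         ≡⟨ ρ-support {Q = B} suppB x y ⟩
  arr B x y               ∎
  where
  open ≡-Reasoning
  drop-A : ∀ {x y} → x ∈ T → y ∈ T → arr (A ⊕ B) x y ≡ arr B x y
  drop-A {x} {y} x∈T _ =
    trans (cong (ℤ._+ arr B x y) (suppA x y (disjoint x∈T))) (+-identityˡ (arr B x y))

relabel : ℕ ↔ ℕ → Quiver → Quiver
arr  (relabel σ Q) x y = arr Q (from σ x) (from σ y)
skew (relabel σ Q) x y = skew Q (from σ x) (from σ y)

relabel-supported : (σ : ℕ ↔ ℕ) → SupportedOn S Q → SupportedOn (map (to σ) S) (relabel σ Q)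
relabel-supported {S = S} {Q = Q} σ supp x y x∉σS =
  supp (from σ x) (from σ y) (x∉σS ∘ subst (_∈ map (to σ) S) (strictlyInverseˡ σ x) ∘ ∈-map⁺ (to σ))

module _ {P : QSet} (isProperty : IsProperty P) where

  ≈Q-resp : A ≈Q B → P A → P B
  ≈Q-resp {A = A} {B = B} A≈B = isProperty A B ↔-refl (λ x y → sym (A≈B x y))

  relabel-preserves : (σ : ℕ ↔ ℕ) → P Q → P (relabel σ Q)
  relabel-preserves {Q = Q} σ = isProperty Q (relabel σ Q) σ
    (λ x y → cong₂ (arr Q) (strictlyInverseʳ σ x) (strictlyInverseʳ σ y))

  relabel-reflects : (σ : ℕ ↔ ℕ) → P (relabel σ Q) → P Q
  relabel-reflects {Q = Q} σ = isProperty (relabel σ Q) Q (↔-sym σ) (λ x y → refl)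

  module Obstructed (hereditary : Hereditary P) {Q₀ : Quiver} (fin₀ : Finite Q₀) (Q₀∉P : ¬ P Q₀) where

    obstruction-isolates : ∀ Q → SupportedOn S Q₀ → InU Q₀ S Q → ¬ P Q
    obstruction-isolates {S = S} Q supp Q∈U Q∈P =
      Q₀∉P (≈Q-resp (λ x y → trans (Q∈U x y) (ρ-support {Q = Q₀} supp x y)) (hereditary Q S Q∈P))

    plant-obstruction : ∀ Q → SupportedOn S Q →
      Σ Quiver λ Q' → Finite Q' × ¬ P Q' × (∀ {x} → x ∈ S → ∀ y → arr Q' x y ≡ arr Q x y)
    plant-obstruction {S = S} Q supp =
      Q ⊕ copy , (S ++ S-copy , ⊕-supported {A = Q} {B = copy} supp supp-copy) , Q⊕copy∉P ,
      λ x∈S → ⊕-row-outside {B = copy} Q supp-copy (λ x∈S-copy → copy-avoids-S x∈S-copy x∈S)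
      where
      moved = separate (proj₁ fin₀) S
      σ = proj₁ moved
      copy = relabel σ Q₀
      S-copy = map (to σ) (proj₁ fin₀)

      supp-copy : SupportedOn S-copy copy
      supp-copy = relabel-supported {Q = Q₀} σ (proj₂ fin₀)

      copy-avoids-S : ∀ {x} → x ∈ S-copy → x ∉ S
      copy-avoids-S x∈S-copy with ∈-map⁻ (to σ) x∈S-copy
      ... | x₀ , x₀∈S₀ , refl = proj₂ moved x₀∈S₀

      Q⊕copy∉P : ¬ P (Q ⊕ copy)
      Q⊕copy∉P Q⊕copy∈P = Q₀∉P (relabel-reflects σ
        (≈Q-resp (ρ-⊕-disjoint {A = Q} {B = copy} supp supp-copy copy-avoids-S)
          (hereditary (Q ⊕ copy) S-copy Q⊕copy∈P)))

    not-denseAF : ¬ DenseAF P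
    not-denseAF dense =
      let S₀ , supp₀ = fin₀
          Q , Q∈P , Q∈U = dense Q₀ S₀
      in obstruction-isolates Q supp₀ Q∈U Q∈P

    not-denseLF : ¬ DenseLF P
    not-denseLF dense =
      let S₀ , supp₀ = fin₀
          Q , _ , Q∈P , Q∈W = dense Q₀ (finite⇒locFin {Q = Q₀} fin₀) S₀
      in obstruction-isolates Q supp₀ (InW⇒InU {Q = Q₀} {V = S₀} {Q' = Q} Q∈W) Q∈P

    complement-denseAF : DenseAF (λ Q → ¬ P Q)
    complement-denseAF Q V =
      let Q' , _ , Q'∉P , agree = plant-obstruction (ρ V Q) (ρ-supported V Q) in
      Q' , Q'∉P ,
      ρ-cong {A = Q'} {B = Q} (λ x∈V y∈V → trans (agree x∈V _) (ρ-inside {Q = Q} x∈V y∈V))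

    complement-denseLF : DenseLF (λ Q → ¬ P Q)
    complement-denseLF Q lf V =
      let Q' , fin' , Q'∉P , agree = plant-obstruction (Λ V Q) (Λ-supported V Q lf) in
      Q' , finite⇒locFin {Q = Q'} fin' , Q'∉P ,
      Λ-cong {V = V} {A = Q'} {B = Q}
        (λ x∈V y → trans (agree (∈-++⁺ˡ x∈V) y) (Λ-insideˡ {V = V} {Q = Q} x∈V))

-- Forbidden finite subquivers

Occurs : Family → Quiver → List ℕ → Set
Occurs F Q V = Σ ℕ λ n → Σ (FQuiver n) λ G → F n G × RestrIso Q V n G

restrIso-local : ∀ {G : FQuiver n} → RestrIso Q V n G → InU Q V Q' → RestrIso Q' V n G
restrIso-local {Q = Q} {V = V} {Q' = Q'} {G = G} (f , f-inj , f∈V , onto , f-arr) Q'∈U =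
  f , f-inj , f∈V , onto , λ i j → begin
    arr Q' (f i) (f j)         ≡⟨ ρ-inside {Q = Q'} (f∈V i) (f∈V j) ⟨
    arr (ρ V Q') (f i) (f j)   ≡⟨ Q'∈U (f i) (f j) ⟩
    arr (ρ V Q) (f i) (f j)    ≡⟨ ρ-inside {Q = Q} (f∈V i) (f∈V j) ⟩
    arr Q (f i) (f j)          ≡⟨ f-arr i j ⟩
    farr G i j                 ∎
  where open ≡-Reasoning

P[F]-closed : ExcludedMiddle 0ℓ → (F : Family) → ClosedAF P[ F ]
P[F]-closed em F Q Q∉P[F]
  with decidable-stable (em {Σ (List ℕ) (Occurs F Q)}) (Q∉P[F] ∘ curry)
... | V , n , G , G∈F , occurs =
  V , λ Q' Q'∈U Q'∈P[F] →
    Q'∈P[F] V (n , G , G∈F , restrIso-local {Q = Q} {V = V} {Q' = Q'} {G = G} occurs Q'∈U)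

ClosedAF-resp : ∀ {P P′ : QSet} → (∀ Q → (P Q → P′ Q) × (P′ Q → P Q)) → ClosedAF P → ClosedAF P′
ClosedAF-resp P⇔P′ closed Q Q∉P′ =
  let V , isolated = closed Q (Q∉P′ ∘ proj₁ (P⇔P′ Q)) in
  V , λ Q' Q'∈U → isolated Q' Q'∈U ∘ proj₂ (P⇔P′ Q')

Obstruction : QSet → Family
Obstruction P n G = ∀ Q V → RestrIso Q V n G → ¬ P Q

prefix : ∀ M → Quiver → FQuiver M
farr  (prefix M Q) i j = arr Q (toℕ i) (toℕ j)
fskew (prefix M Q) i j = skew Q (toℕ i) (toℕ j)

prefix-occurs : ∀ M Q → RestrIso Q (upTo M) M (prefix M Q)
prefix-occurs M Q =
  toℕ , (λ _ _ → toℕ-injective) , ∈-upTo⁺ ∘ toℕ<n ,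
  (λ x x∈ → fromℕ< (∈-upTo⁻ x∈) , toℕ-fromℕ< (∈-upTo⁻ x∈)) , λ _ _ → refl

module _ {P : QSet} (isProperty : IsProperty P) where

  prefix-obstruction : (∀ Q' → InU Q V Q' → ¬ P Q') → Obstruction P (bound V) (prefix (bound V) Q)
  prefix-obstruction {Q = Q} {V = V} isolated Q' _ (f , f-inj , _ , _ , f-arr) Q'∈P =
    isolated (relabel (↔-sym σ) Q') (ρ-cong {A = relabel (↔-sym σ) Q'} {B = Q} agrees)
      (relabel-preserves isProperty (↔-sym σ) Q'∈P)
    where
    extended = extend-injectionᶠ f f-inj
    σ = proj₁ extended

    agrees : ∀ {x y} → x ∈ V → y ∈ V → arr Q' (to σ x) (to σ y) ≡ arr Q x y
    agrees {x} {y} x∈V y∈V = begin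
      arr Q' (to σ x) (to σ y)
        ≡⟨ cong₂ (arr Q') (proj₂ extended x<M) (proj₂ extended y<M) ⟩
      arr Q' (f (fromℕ< x<M)) (f (fromℕ< y<M))
        ≡⟨ f-arr (fromℕ< x<M) (fromℕ< y<M) ⟩
      arr Q (toℕ (fromℕ< x<M)) (toℕ (fromℕ< y<M))
        ≡⟨ cong₂ (arr Q) (toℕ-fromℕ< x<M) (toℕ-fromℕ< y<M) ⟩
      arr Q x y
        ∎
      where
      open ≡-Reasoning
      x<M = <-bound x∈V
      y<M = <-bound y∈V

  closed⇒obstructions-characterise : ExcludedMiddle 0ℓ → ClosedAF P →
    ∀ Q → (P Q → P[ Obstruction P ] Q) × (P[ Obstruction P ] Q → P Q)
  closed⇒obstructions-characterise em closed Q =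
    (λ Q∈P V (_ , _ , G-obstruction , occurs) → G-obstruction Q V occurs Q∈P) ,
    λ Q∈P[O] → decidable-stable em λ Q∉P →
      let V , isolated = closed Q Q∉P in
      Q∈P[O] (upTo (bound V))
        (bound V , prefix (bound V) Q , prefix-obstruction {Q = Q} {V = V} isolated , prefix-occurs (bound V) Q)

theorem1p2 : (P : QSet) → IsProperty P → Hereditary P →
    (Σ Quiver λ Q → Finite Q × ¬ P Q) →
    ¬ DenseLF P × ¬ DenseAF P ×
    DenseLF (λ Q → ¬ P Q) × DenseAF (λ Q → ¬ P Q) ×
    (ExcludedMiddle 0ℓ →
      ((Σ Family λ F → ∀ Q → (P Q → P[ F ] Q) × (P[ F ] Q → P Q)) → ClosedAF P) ×
      (ClosedAF P → Σ Family λ F → ∀ Q → (P Q → P[ F ] Q) × (P[ F ] Q → P Q)))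
theorem1p2 P isProperty hereditary (Q₀ , fin₀ , Q₀∉P) =
  not-denseLF , not-denseAF , complement-denseLF , complement-denseAF ,
  λ em → (λ (F , P⇔P[F]) → ClosedAF-resp (λ Q → swap (P⇔P[F] Q)) (P[F]-closed em F)) ,
         (λ closed → Obstruction P , closed⇒obstructions-characterise isProperty em closed)
  where open Obstructed isProperty hereditary fin₀ Q₀∉P
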